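{- Let $\Delta$ be a finite pure simplicial complex of rank $n$ (every chamber has $n$ vertices), equipped with maps $R_C:\mathcal{C}\to\mathcal{F}$ ($C\in\mathcal{C}$) satisfying the restriction axioms (R1)–(R3). Fix a chamber $C$ and put $\beta_j=|\{D\in\mathcal{C}: R_C(D)\text{ has rank } j\}|$. Then $\beta_j=h_j(\Delta)$ for all $0\le j\le n$.
   Context: $\mathcal{F}$ is the set of faces (including $\emptyset$), $\mathcal{C}$ the set of chambers (maximal faces), $\le$ the face relation; the rank of a face is its number of vertices. Axioms: (R1) $R_C(C)=\emptyset$ and $R_C(D)\le D$; (R2) for each $C$, $\mathcal{F}$ is the disjoint union over $D\in\mathcal{C}$ of $\{F: R_C(D)\le F\le D\}$; (R3) if $C_1,\dots,C_n=D$ are chambers with $R_C(C_i)\le C_{i+1}$ for $1\le i<n$ then $R_{C_1}(D)\le R_C(D)\le D$. $f_j(\Delta)$ is the number of faces of rank $j$, and the $h$-vector is determined by $f_j(\Delta)=\sum_{k=0}^{j}\binom{n-k}{n-j}h_k(\Delta)$ for $0\le j\le n$. -}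

module Defs where

open import Data.Nat using (ℕ; zero; suc; _≤_; _∸_)
open import Data.Nat.Combinatorics renaming (_C_ to _choose_)
open import Data.Integer using (ℤ; +_) renaming (_+_ to _+ℤ_; _*_ to _*ℤ_)
open import Data.Bool using (Bool; true; false; T; _∧_; not)
open import Data.List using (List; []; _∷_; _++_; map; filter; length)
open import Data.Bool.ListAction using (any)
open import Data.Vec using (_∷_; [])
open import Data.Fin using (Fin; zero; suc; inject₁; fromℕ)
open import Data.Fin.Subset using (Subset; inside; outside; _⊆_; _⊂_; ∣_∣; ⊥)
open import Data.Fin.Subset.Properties using (_⊂?_)
open import Data.Product using (Σ; _×_; ∃; _,_)
open import Relation.Nullary.Decidable using (⌊_⌋)
open import Relation.Binary.PropositionalEquality using (_≡_)
open import Data.Nat.Properties using (_≟_)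

allSubsets : (m : ℕ) → List (Subset m)
allSubsets zero = [] ∷ []
allSubsets (suc m) = map (inside ∷_) (allSubsets m) ++ map (outside ∷_) (allSubsets m)

countSubsets : {m : ℕ} → (Subset m → Bool) → ℕ
countSubsets {m} p = length (filter (λ F → T? (p F)) (allSubsets m))
  where
  open import Data.Bool.Properties using (T?)

record SimplicialComplex (m : ℕ) : Set where
  field
    isFace      : Subset m → Bool
    empty-face  : T (isFace ⊥)
    down-closed : ∀ {F G : Subset m} → G ⊆ F → T (isFace F) → T (isFace G)

  IsFace : Subset m → Set
  IsFace F = T (isFace F)

  isChamber : Subset m → Bool
  isChamber F = isFace F ∧ not (any (λ G → isFace G ∧ ⌊ F ⊂? G ⌋) (allSubsets m))

  IsChamber : Subset m → Set
  IsChamber F = T (isChamber F)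

  f : ℕ → ℕ
  f j = countSubsets (λ F → isFace F ∧ ⌊ ∣ F ∣ ≟ j ⌋)

Pure : {m : ℕ} → SimplicialComplex m → ℕ → Set
Pure Δ n = ∀ (C : Subset _) → IsChamber C → ∣ C ∣ ≡ n
  where open SimplicialComplex Δ

-- Restriction axioms (R1)-(R3) for a family R C D = R_C(D) (values at non-chambers irrelevant).
record IsRestriction {m : ℕ} (Δ : SimplicialComplex m) (R : Subset m → Subset m → Subset m) : Set where
  open SimplicialComplex Δ
  field
    R1-self : ∀ C → IsChamber C → R C C ≡ ⊥
    R1-sub  : ∀ C D → IsChamber C → IsChamber D → R C D ⊆ D
    R2-cover  : ∀ C → IsChamber C → ∀ F → IsFace F →
                  Σ (Subset m) λ D → IsChamber D × R C D ⊆ F × F ⊆ D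
    R2-unique : ∀ C → IsChamber C → ∀ F D D′ → IsChamber D → IsChamber D′ →
                  R C D ⊆ F → F ⊆ D → R C D′ ⊆ F → F ⊆ D′ → D ≡ D′
    -- (R3): chambers C₁,…,C_{k+1} = D (indexed by Fin (suc k)) with R_C(C_i) ≤ C_{i+1}
    R3 : ∀ C → IsChamber C → (k : ℕ) → (Cs : Fin (suc k) → Subset m) →
           (∀ i → IsChamber (Cs i)) →
           (∀ (i : Fin k) → R C (Cs (inject₁ i)) ⊆ Cs (suc i)) →
           R (Cs zero) (Cs (fromℕ k)) ⊆ R C (Cs (fromℕ k)) × R C (Cs (fromℕ k)) ⊆ Cs (fromℕ k)

sumTo : ℕ → (ℕ → ℤ) → ℤ
sumTo zero g = g zero
sumTo (suc j) g = sumTo j g +ℤ g (suc j)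

-- h is the h-vector of Δ (rank n): f_j = Σ_{k=0}^{j} C(n-k, n-j) h_k for 0 ≤ j ≤ n.
-- (Triangular system with unit diagonal, so h is uniquely determined in ℤ.)
IsHVector : {m : ℕ} → SimplicialComplex m → ℕ → (ℕ → ℤ) → Set
IsHVector Δ n h = ∀ j → j ≤ n →
  + (SimplicialComplex.f Δ j) ≡ sumTo j (λ k → + ((n ∸ k) choose (n ∸ j)) *ℤ h k)

β : {m : ℕ} → SimplicialComplex m → (Subset m → Subset m → Subset m) → Subset m → ℕ → ℕ
β Δ R C j = countSubsets (λ D → isChamber D ∧ ⌊ ∣ R C D ∣ ≟ j ⌋)
  where open SimplicialComplex Δ

{-# OPTIONS --safe #-}
-- By (R2) the faces of Δ are partitioned into the intervals [R_C(D), D], D ∈ 𝒞.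
-- If R_C(D) has rank k and D rank n, that interval contains C(n − k, j − k) = C(n − k, n − j)
-- faces of rank j, so counting the faces of rank j chamber by chamber gives
-- f_j = Σ_{k ≤ j} C(n − k, n − j) β_k. This is the triangular system defining the h-vector,
-- whose diagonal coefficients C(n − j, n − j) are 1, hence β_j = h_j.
-- Only R_C(D) ≤ D and (R2) are needed.
module Submission where

open import Defs
open import Data.Bool using (Bool; true; false; T; _∧_)
open import Data.Bool.Properties using (T?; T-∧; ∧-zeroʳ)
open import Data.Empty using (⊥-elim)
open import Data.Fin.Subset using (Subset; inside; outside; _⊆_; _─_; ∣_∣)
open import Data.Fin.Subset.Properties using (_⊆?_; drop-∷-⊆)
open import Data.Integer using (ℤ; +_; 1ℤ) renaming (_+_ to _+ℤ_; _*_ to _*ℤ_)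
open import Data.Integer.Properties using (+-0-abelianGroup; pos-+; pos-*; *-identityˡ)
open import Data.List using (List; []; _∷_; _++_; map; filter; length)
open import Data.List.Properties using (map-++; map-∘)
open import Data.Nat using (ℕ; zero; suc; _+_; _*_; _∸_; _≤_; _<_; _≟_; s≤s; z≤n)
open import Data.Nat.Combinatorics using (nCn≡1; nCk≡nC[n∸k]; nCk+nC[k+1]≡[n+1]C[k+1])
  renaming (_C_ to _choose_)
open import Data.Nat.ListAction using (sum)
open import Data.Nat.ListAction.Properties using (sum-++)
open import Data.Nat.Properties
  using (+-commutativeSemigroup; +-identityʳ; +-suc; *-zeroʳ; *-comm; *-distribˡ-+; *-distribʳ-+;
         ≤-refl; <⇒≤; <⇒≢; ≤-<-trans; m≤n⇒m≤1+n; m≤n⇒m<n∨m≡n; ≰⇒>; _≤?_; +-cancelˡ-≤;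
         m≤n⇒∃[o]m+o≡n; m+n∸m≡n; [m+n]∸[m+o]≡n∸o)
open import Data.Product using (_×_; _,_; proj₁; proj₂)
open import Data.Sum using (inj₁; inj₂)
open import Data.Vec using (_∷_; []; here)
open import Data.Vec.Properties using (∷-injectiveʳ)
open import Function using (_∘_; Equivalence)
open import Relation.Binary.PropositionalEquality
open import Relation.Nullary using (Dec; does; ¬_; yes; no)
open import Relation.Nullary.Decidable using (⌊_⌋; isYes≗does; toWitness; dec-true; dec-false)
open import Algebra.Properties.AbelianGroup +-0-abelianGroup using (∙-cancelˡ)
open import Algebra.Properties.CommutativeSemigroup +-commutativeSemigroup using (interchange)

𝟙 : Bool → ℕ
𝟙 true  = 1
𝟙 false = 0

𝟙-∧ : ∀ a b → 𝟙 (a ∧ b) ≡ 𝟙 a * 𝟙 b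
𝟙-∧ false b = refl
𝟙-∧ true  b = sym (+-identityʳ (𝟙 b))

𝟙-∧-* : ∀ a b x → 𝟙 (a ∧ b) * x ≡ 𝟙 a * (𝟙 b * x)
𝟙-∧-* false b x = refl
𝟙-∧-* true  b x = sym (+-identityʳ (𝟙 b * x))

𝟙-*-cong : ∀ b {x y} → (T b → x ≡ y) → 𝟙 b * x ≡ 𝟙 b * y
𝟙-*-cong false eq = refl
𝟙-*-cong true  eq = cong (_+ 0) (eq _)

𝟙-T : ∀ {b} → T b → 𝟙 b ≡ 1
𝟙-T {true} _ = refl

𝟙-¬T : ∀ {b} → ¬ T b → 𝟙 b ≡ 0
𝟙-¬T {true}  ¬Tb = ⊥-elim (¬Tb _)
𝟙-¬T {false} _   = refl

T-does⇒ : ∀ {P : Set} (P? : Dec P) → T (does P?) → P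
T-does⇒ P? = toWitness ∘ subst T (sym (isYes≗does P?))

⇒T-does : ∀ {P : Set} (P? : Dec P) → P → T (does P?)
⇒T-does P? p = subst T (sym (dec-true P? p)) _

∑ₛ : (m : ℕ) → (Subset m → ℕ) → ℕ
∑ₛ zero    g = g []
∑ₛ (suc m) g = ∑ₛ m (g ∘ (inside ∷_)) + ∑ₛ m (g ∘ (outside ∷_))

∑ₛ-cong : ∀ {m} {g g′ : Subset m → ℕ} → (∀ F → g F ≡ g′ F) → ∑ₛ m g ≡ ∑ₛ m g′
∑ₛ-cong {zero}  eq = eq []
∑ₛ-cong {suc m} eq = cong₂ _+_ (∑ₛ-cong (eq ∘ (inside ∷_))) (∑ₛ-cong (eq ∘ (outside ∷_)))

∑ₛ-zero : ∀ {m} {g : Subset m → ℕ} → (∀ F → g F ≡ 0) → ∑ₛ m g ≡ 0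
∑ₛ-zero {zero}  eq = eq []
∑ₛ-zero {suc m} eq = cong₂ _+_ (∑ₛ-zero (eq ∘ (inside ∷_))) (∑ₛ-zero (eq ∘ (outside ∷_)))

∑ₛ-single : ∀ {m} {g : Subset m → ℕ} (F₀ : Subset m) → (∀ F → F ≢ F₀ → g F ≡ 0) → ∑ₛ m g ≡ g F₀
∑ₛ-single {zero}  []             _  = refl
∑ₛ-single {suc m} (inside ∷ F₀)  eq = trans
  (cong₂ _+_ (∑ₛ-single {m} F₀ λ F F≢F₀ → eq (inside ∷ F) (F≢F₀ ∘ ∷-injectiveʳ))
             (∑ₛ-zero {m} λ F → eq (outside ∷ F) λ ()))
  (+-identityʳ _)
∑ₛ-single {suc m} (outside ∷ F₀) eq =
  cong₂ _+_ (∑ₛ-zero {m} λ F → eq (inside ∷ F) λ ())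
            (∑ₛ-single {m} F₀ λ F F≢F₀ → eq (outside ∷ F) (F≢F₀ ∘ ∷-injectiveʳ))

∑ₛ-distrib-+ : ∀ {m} (g g′ : Subset m → ℕ) → ∑ₛ m (λ F → g F + g′ F) ≡ ∑ₛ m g + ∑ₛ m g′
∑ₛ-distrib-+ {zero}  g g′ = refl
∑ₛ-distrib-+ {suc m} g g′ = trans
  (cong₂ _+_ (∑ₛ-distrib-+ (g ∘ (inside ∷_)) (g′ ∘ (inside ∷_)))
             (∑ₛ-distrib-+ (g ∘ (outside ∷_)) (g′ ∘ (outside ∷_))))
  (interchange (∑ₛ m (g ∘ (inside ∷_))) _ (∑ₛ m (g ∘ (outside ∷_))) _)

∑ₛ-*ˡ : ∀ {m} (c : ℕ) (g : Subset m → ℕ) → ∑ₛ m (λ F → c * g F) ≡ c * ∑ₛ m g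
∑ₛ-*ˡ {zero}  c g = refl
∑ₛ-*ˡ {suc m} c g = trans
  (cong₂ _+_ (∑ₛ-*ˡ c (g ∘ (inside ∷_))) (∑ₛ-*ˡ c (g ∘ (outside ∷_))))
  (sym (*-distribˡ-+ c _ _))

∑ₛ-*ʳ : ∀ {m} (c : ℕ) (g : Subset m → ℕ) → ∑ₛ m (λ F → g F * c) ≡ ∑ₛ m g * c
∑ₛ-*ʳ {zero}  c g = refl
∑ₛ-*ʳ {suc m} c g = trans
  (cong₂ _+_ (∑ₛ-*ʳ c (g ∘ (inside ∷_))) (∑ₛ-*ʳ c (g ∘ (outside ∷_))))
  (sym (*-distribʳ-+ c (∑ₛ m (g ∘ (inside ∷_))) _))

∑ₛ-comm : ∀ {m m′} (g : Subset m → Subset m′ → ℕ) →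
          ∑ₛ m (λ D → ∑ₛ m′ (g D)) ≡ ∑ₛ m′ (λ F → ∑ₛ m (λ D → g D F))
∑ₛ-comm {zero}  g = refl
∑ₛ-comm {suc m} g = trans
  (cong₂ _+_ (∑ₛ-comm (g ∘ (inside ∷_))) (∑ₛ-comm (g ∘ (outside ∷_))))
  (sym (∑ₛ-distrib-+ (λ F → ∑ₛ m (λ D → g (inside ∷ D) F)) (λ F → ∑ₛ m (λ D → g (outside ∷ D) F))))

length-filter-T? : {A : Set} (p : A → Bool) (xs : List A) →
                   length (filter (T? ∘ p) xs) ≡ sum (map (𝟙 ∘ p) xs)
length-filter-T? p []       = refl
length-filter-T? p (x ∷ xs) with p x
... | true  = cong suc (length-filter-T? p xs)
... | false = length-filter-T? p xs

sum-map-allSubsets : ∀ {m} (g : Subset m → ℕ) → sum (map g (allSubsets m)) ≡ ∑ₛ m g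
sum-map-allSubsets {zero}  g = +-identityʳ (g [])
sum-map-allSubsets {suc m} g = begin
  sum (map g (map (inside ∷_) Fs ++ map (outside ∷_) Fs))
    ≡⟨ cong sum (map-++ g (map (inside ∷_) Fs) _) ⟩
  sum (map g (map (inside ∷_) Fs) ++ map g (map (outside ∷_) Fs))
    ≡⟨ sum-++ (map g (map (inside ∷_) Fs)) _ ⟩
  sum (map g (map (inside ∷_) Fs)) + sum (map g (map (outside ∷_) Fs))
    ≡⟨ cong₂ _+_ (cong sum (map-∘ Fs)) (cong sum (map-∘ Fs)) ⟨
  sum (map (g ∘ (inside ∷_)) Fs) + sum (map (g ∘ (outside ∷_)) Fs)
    ≡⟨ cong₂ _+_ (sum-map-allSubsets {m} _) (sum-map-allSubsets {m} _) ⟩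
  ∑ₛ (suc m) g ∎
  where
  open ≡-Reasoning
  Fs = allSubsets m

countSubsets≡∑ₛ : ∀ {m} (p : Subset m → Bool) → countSubsets p ≡ ∑ₛ m (𝟙 ∘ p)
countSubsets≡∑ₛ {m} p = trans (length-filter-T? p (allSubsets m)) (sum-map-allSubsets (𝟙 ∘ p))

sumUpTo : ℕ → (ℕ → ℕ) → ℕ
sumUpTo zero    g = g zero
sumUpTo (suc j) g = sumUpTo j g + g (suc j)

sumUpTo-cong : ∀ j {g g′ : ℕ → ℕ} → (∀ k → g k ≡ g′ k) → sumUpTo j g ≡ sumUpTo j g′
sumUpTo-cong zero    eq = eq zero
sumUpTo-cong (suc j) eq = cong₂ _+_ (sumUpTo-cong j eq) (eq (suc j))

sumUpTo-zero : ∀ j {g : ℕ → ℕ} → (∀ k → k ≤ j → g k ≡ 0) → sumUpTo j g ≡ 0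
sumUpTo-zero zero    eq = eq zero z≤n
sumUpTo-zero (suc j) eq =
  cong₂ _+_ (sumUpTo-zero j λ k k≤j → eq k (m≤n⇒m≤1+n k≤j)) (eq (suc j) ≤-refl)

sumUpTo-single : ∀ {j} {g : ℕ → ℕ} a → a ≤ j → (∀ k → k ≤ j → k ≢ a → g k ≡ 0) → sumUpTo j g ≡ g a
sumUpTo-single {zero}  zero z≤n _  = refl
sumUpTo-single {suc j} {g} a a≤1+j eq with m≤n⇒m<n∨m≡n a≤1+j
... | inj₁ (s≤s a≤j) = trans
  (cong₂ _+_ (sumUpTo-single a a≤j λ k k≤j → eq k (m≤n⇒m≤1+n k≤j))
             (eq (suc j) ≤-refl λ 1+j≡a → <⇒≢ (s≤s a≤j) (sym 1+j≡a)))
  (+-identityʳ (g a))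
... | inj₂ refl =
  cong (_+ g a) (sumUpTo-zero j λ k k≤j → eq k (m≤n⇒m≤1+n k≤j) (<⇒≢ (s≤s k≤j)))

sumUpTo-*ˡ : ∀ j c (g : ℕ → ℕ) → c * sumUpTo j g ≡ sumUpTo j (λ k → c * g k)
sumUpTo-*ˡ zero    c g = refl
sumUpTo-*ˡ (suc j) c g =
  trans (*-distribˡ-+ c (sumUpTo j g) (g (suc j))) (cong (_+ c * g (suc j)) (sumUpTo-*ˡ j c g))

sumUpTo-𝟙≟ : ∀ {j} {g : ℕ → ℕ} a → a ≤ j → sumUpTo j (λ k → 𝟙 (does (a ≟ k)) * g k) ≡ g a
sumUpTo-𝟙≟ {j} {g} a a≤j = begin
  sumUpTo j (λ k → 𝟙 (does (a ≟ k)) * g k)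
    ≡⟨ sumUpTo-single a a≤j (λ k _ k≢a → cong (λ b → 𝟙 b * g k) (dec-false (a ≟ k) (k≢a ∘ sym))) ⟩
  𝟙 (does (a ≟ a)) * g a
    ≡⟨ cong (λ b → 𝟙 b * g a) (dec-true (a ≟ a) refl) ⟩
  g a + 0
    ≡⟨ +-identityʳ (g a) ⟩
  g a ∎
  where open ≡-Reasoning

sumUpTo-𝟙≟-above : ∀ {j} {g : ℕ → ℕ} a → j < a → sumUpTo j (λ k → 𝟙 (does (a ≟ k)) * g k) ≡ 0
sumUpTo-𝟙≟-above {j} {g} a j<a = sumUpTo-zero j λ k k≤j →
  cong (λ b → 𝟙 b * g k) (dec-false (a ≟ k) λ a≡k → <⇒≢ (≤-<-trans k≤j j<a) (sym a≡k))

∑ₛ-sumUpTo-comm : ∀ {m} j (g : Subset m → ℕ → ℕ) →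
                  ∑ₛ m (λ D → sumUpTo j (g D)) ≡ sumUpTo j (λ k → ∑ₛ m (λ D → g D k))
∑ₛ-sumUpTo-comm zero    g = refl
∑ₛ-sumUpTo-comm (suc j) g = trans
  (∑ₛ-distrib-+ (λ D → sumUpTo j (g D)) (λ D → g D (suc j)))
  (cong (_+ ∑ₛ _ (λ D → g D (suc j))) (∑ₛ-sumUpTo-comm j g))

sumTo-cong : ∀ j {f g : ℕ → ℤ} → (∀ k → k ≤ j → f k ≡ g k) → sumTo j f ≡ sumTo j g
sumTo-cong zero    eq = eq zero z≤n
sumTo-cong (suc j) eq =
  cong₂ _+ℤ_ (sumTo-cong j λ k k≤j → eq k (m≤n⇒m≤1+n k≤j)) (eq (suc j) ≤-refl)

+-sumUpTo : ∀ j (g : ℕ → ℕ) → + sumUpTo j g ≡ sumTo j (+_ ∘ g)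
+-sumUpTo zero    g = refl
+-sumUpTo (suc j) g =
  trans (pos-+ (sumUpTo j g) (g (suc j))) (cong (_+ℤ + g (suc j)) (+-sumUpTo j g))

-- The coefficient of xʲ in xᵃ (1 + x)ᵉ.
shiftedBinomial : ℕ → ℕ → ℕ → ℕ
shiftedBinomial zero    e j       = e choose j
shiftedBinomial (suc a) e zero    = 0
shiftedBinomial (suc a) e (suc j) = shiftedBinomial a e j

shiftedBinomial-suc-zero : ∀ a e → shiftedBinomial a (suc e) 0 ≡ shiftedBinomial a e 0
shiftedBinomial-suc-zero zero    e = refl
shiftedBinomial-suc-zero (suc a) e = refl

shiftedBinomial-pascal : ∀ a e j →
  shiftedBinomial a e j + shiftedBinomial a e (suc j) ≡ shiftedBinomial a (suc e) (suc j)
shiftedBinomial-pascal zero    e j       = nCk+nC[k+1]≡[n+1]C[k+1] e j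
shiftedBinomial-pascal (suc a) e zero    = sym (shiftedBinomial-suc-zero a e)
shiftedBinomial-pascal (suc a) e (suc j) = shiftedBinomial-pascal a e j

shiftedBinomial-below : ∀ {a j} e → j < a → shiftedBinomial a e j ≡ 0
shiftedBinomial-below {suc a} {zero}  e _         = refl
shiftedBinomial-below {suc a} {suc j} e (s≤s j<a) = shiftedBinomial-below e j<a

shiftedBinomial-+ : ∀ a e t → shiftedBinomial a e (a + t) ≡ e choose t
shiftedBinomial-+ zero    e t = refl
shiftedBinomial-+ (suc a) e t = shiftedBinomial-+ a e t

shiftedBinomial≡sumUpTo : ∀ {a e j} → j ≤ a + e →
  shiftedBinomial a e j ≡ sumUpTo j (λ k → 𝟙 (does (a ≟ k)) * ((a + e ∸ k) choose (a + e ∸ j)))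
shiftedBinomial≡sumUpTo {a} {e} {j} j≤a+e with a ≤? j
... | no a≰j = trans (shiftedBinomial-below e (≰⇒> a≰j)) (sym (sumUpTo-𝟙≟-above a (≰⇒> a≰j)))
... | yes a≤j with m≤n⇒∃[o]m+o≡n a≤j
...   | t , refl = begin
  shiftedBinomial a e (a + t)           ≡⟨ shiftedBinomial-+ a e t ⟩
  e choose t                            ≡⟨ nCk≡nC[n∸k] (+-cancelˡ-≤ a t e j≤a+e) ⟩
  e choose (e ∸ t)                      ≡⟨ cong₂ _choose_ (m+n∸m≡n a e) ([m+n]∸[m+o]≡n∸o a e t) ⟨
  (a + e ∸ a) choose (a + e ∸ (a + t))  ≡⟨ sumUpTo-𝟙≟ a a≤j ⟨
  sumUpTo (a + t) (λ k → 𝟙 (does (a ≟ k)) * ((a + e ∸ k) choose (a + e ∸ (a + t)))) ∎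
  where open ≡-Reasoning

⊆⇒∣q∣≡∣p∣+∣q─p∣ : ∀ {m} {p q : Subset m} → p ⊆ q → ∣ q ∣ ≡ ∣ p ∣ + ∣ q ─ p ∣
⊆⇒∣q∣≡∣p∣+∣q─p∣ {p = []}          {[]}          _   = refl
⊆⇒∣q∣≡∣p∣+∣q─p∣ {p = inside ∷ p}  {inside ∷ q}  p⊆q = cong suc (⊆⇒∣q∣≡∣p∣+∣q─p∣ (drop-∷-⊆ p⊆q))
⊆⇒∣q∣≡∣p∣+∣q─p∣ {p = inside ∷ p}  {outside ∷ q} p⊆q with () ← p⊆q here
⊆⇒∣q∣≡∣p∣+∣q─p∣ {p = outside ∷ p} {inside ∷ q}  p⊆q =
  trans (cong suc (⊆⇒∣q∣≡∣p∣+∣q─p∣ (drop-∷-⊆ p⊆q))) (sym (+-suc ∣ p ∣ ∣ q ─ p ∣))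
⊆⇒∣q∣≡∣p∣+∣q─p∣ {p = outside ∷ p} {outside ∷ q} p⊆q = ⊆⇒∣q∣≡∣p∣+∣q─p∣ (drop-∷-⊆ p⊆q)

-- Tests are written with `does` rather than ⌊_⌋ because only `does` computes through
-- Dec.map′, which lets inInterval and the rank test reduce on `inside ∷ _` and `outside ∷ _`.
inInterval : ∀ {m} → Subset m → Subset m → Subset m → Bool
inInterval A D F = does (A ⊆? F) ∧ does (F ⊆? D)

inInterval⁻ : ∀ {m} {A D F : Subset m} → T (inInterval A D F) → A ⊆ F × F ⊆ D
inInterval⁻ {A = A} {D} {F} t with A⊆F , F⊆D ← Equivalence.to T-∧ t =
  T-does⇒ (A ⊆? F) A⊆F , T-does⇒ (F ⊆? D) F⊆D

inInterval⁺ : ∀ {m} {A D F : Subset m} → A ⊆ F → F ⊆ D → T (inInterval A D F)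
inInterval⁺ {A = A} {D} {F} A⊆F F⊆D =
  Equivalence.from T-∧ (⇒T-does (A ⊆? F) A⊆F , ⇒T-does (F ⊆? D) F⊆D)

intervalRankCount : ∀ {m} → Subset m → Subset m → ℕ → ℕ
intervalRankCount {m} A D j = ∑ₛ m (λ F → 𝟙 (inInterval A D F) * 𝟙 (does (∣ F ∣ ≟ j)))

intervalRankCount≡shiftedBinomial : ∀ {m} {A D : Subset m} → A ⊆ D → ∀ j →
  intervalRankCount A D j ≡ shiftedBinomial ∣ A ∣ ∣ D ─ A ∣ j
intervalRankCount≡shiftedBinomial {A = []} {[]} _ zero    = refl
intervalRankCount≡shiftedBinomial {A = []} {[]} _ (suc j) = refl
intervalRankCount≡shiftedBinomial {m = suc m} {inside ∷ A} {inside ∷ D} A⊆D zero =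
  cong₂ _+_ (∑ₛ-zero λ F → *-zeroʳ (𝟙 (inInterval A D F))) (∑ₛ-zero {m} λ _ → refl)
intervalRankCount≡shiftedBinomial {m = suc m} {inside ∷ A} {inside ∷ D} A⊆D (suc j) = trans
  (cong₂ _+_ (intervalRankCount≡shiftedBinomial (drop-∷-⊆ A⊆D) j) (∑ₛ-zero {m} λ _ → refl))
  (+-identityʳ _)
intervalRankCount≡shiftedBinomial {A = inside ∷ A} {outside ∷ D} A⊆D j with () ← A⊆D here
intervalRankCount≡shiftedBinomial {A = outside ∷ A} {inside ∷ D} A⊆D zero = trans
  (cong₂ _+_ (∑ₛ-zero λ F → *-zeroʳ (𝟙 (inInterval A D F)))
             (intervalRankCount≡shiftedBinomial (drop-∷-⊆ A⊆D) zero))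
  (sym (shiftedBinomial-suc-zero ∣ A ∣ ∣ D ─ A ∣))
intervalRankCount≡shiftedBinomial {A = outside ∷ A} {inside ∷ D} A⊆D (suc j) = trans
  (cong₂ _+_ (intervalRankCount≡shiftedBinomial (drop-∷-⊆ A⊆D) j)
             (intervalRankCount≡shiftedBinomial (drop-∷-⊆ A⊆D) (suc j)))
  (shiftedBinomial-pascal ∣ A ∣ ∣ D ─ A ∣ j)
intervalRankCount≡shiftedBinomial {A = outside ∷ A} {outside ∷ D} A⊆D j =
  cong₂ _+_ (∑ₛ-zero λ F → cong (λ b → 𝟙 b * 𝟙 (does (suc ∣ F ∣ ≟ j))) (∧-zeroʳ (does (A ⊆? F))))
            (intervalRankCount≡shiftedBinomial (drop-∷-⊆ A⊆D) j)

intervalRankCount≡sumUpTo : ∀ {m n j} {A D : Subset m} → A ⊆ D → ∣ D ∣ ≡ n → j ≤ n →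
  intervalRankCount A D j ≡ sumUpTo j (λ k → 𝟙 (does (∣ A ∣ ≟ k)) * ((n ∸ k) choose (n ∸ j)))
intervalRankCount≡sumUpTo {j = j} {A} {D} A⊆D ∣D∣≡n j≤n
  with refl ← trans (sym ∣D∣≡n) (⊆⇒∣q∣≡∣p∣+∣q─p∣ A⊆D) =
  trans (intervalRankCount≡shiftedBinomial A⊆D j) (shiftedBinomial≡sumUpTo {∣ A ∣} {∣ D ─ A ∣} j≤n)

module _ {m : ℕ} (Δ : SimplicialComplex m) {R : Subset m → Subset m → Subset m}
         (isR : IsRestriction Δ R) {C : Subset m} (chC : SimplicialComplex.IsChamber Δ C) where

  open SimplicialComplex Δ
  open IsRestriction isR

  inChamberInterval : Subset m → Subset m → Bool
  inChamberInterval D F = isChamber D ∧ inInterval (R C D) D F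

  inChamberInterval⁻ : ∀ {D F} → T (inChamberInterval D F) → IsChamber D × R C D ⊆ F × F ⊆ D
  inChamberInterval⁻ {D} t with chD , inI ← Equivalence.to (T-∧ {isChamber D}) t =
    chD , inInterval⁻ {A = R C D} inI

  𝟙-isFace≡∑ₛ-chambers : ∀ F → 𝟙 (isFace F) ≡ ∑ₛ m (λ D → 𝟙 (inChamberInterval D F))
  𝟙-isFace≡∑ₛ-chambers F with T? (isFace F)
  ... | no ¬F-face =
    trans (𝟙-¬T ¬F-face) (sym (∑ₛ-zero {m} λ D → 𝟙-¬T (¬F-face ∘ face-of-chamber D)))
    where
    face-of-chamber : ∀ D → T (inChamberInterval D F) → IsFace F
    face-of-chamber D t with chD , _ , F⊆D ← inChamberInterval⁻ t =
      down-closed F⊆D (proj₁ (Equivalence.to (T-∧ {isFace D}) chD))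
  ... | yes F-face with D₀ , chD₀ , RD₀⊆F , F⊆D₀ ← R2-cover C chC F F-face =
    trans (𝟙-T F-face) (sym (trans (∑ₛ-single D₀ other-chambers-vanish) (𝟙-T D₀-contains-F)))
    where
    D₀-contains-F : T (inChamberInterval D₀ F)
    D₀-contains-F = Equivalence.from (T-∧ {isChamber D₀}) (chD₀ , inInterval⁺ RD₀⊆F F⊆D₀)

    other-chambers-vanish : ∀ D → D ≢ D₀ → 𝟙 (inChamberInterval D F) ≡ 0
    other-chambers-vanish D D≢D₀ = 𝟙-¬T λ t →
      let chD , RD⊆F , F⊆D = inChamberInterval⁻ t
      in  D≢D₀ (R2-unique C chC F D D₀ chD chD₀ RD⊆F F⊆D RD₀⊆F F⊆D₀)

  ∑ₛ-faces≡∑ₛ-chambers : (g : Subset m → ℕ) →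
    ∑ₛ m (λ F → 𝟙 (isFace F) * g F) ≡
    ∑ₛ m (λ D → 𝟙 (isChamber D) * ∑ₛ m (λ F → 𝟙 (inInterval (R C D) D F) * g F))
  ∑ₛ-faces≡∑ₛ-chambers g = begin
    ∑ₛ m (λ F → 𝟙 (isFace F) * g F)
      ≡⟨ ∑ₛ-cong (λ F → trans (cong (_* g F) (𝟙-isFace≡∑ₛ-chambers F)) (sym (∑ₛ-*ʳ {m} (g F) _))) ⟩
    ∑ₛ m (λ F → ∑ₛ m (λ D → 𝟙 (inChamberInterval D F) * g F))
      ≡⟨ ∑ₛ-comm (λ D F → 𝟙 (inChamberInterval D F) * g F) ⟨
    ∑ₛ m (λ D → ∑ₛ m (λ F → 𝟙 (inChamberInterval D F) * g F))
      ≡⟨ ∑ₛ-cong (λ D → trans (∑ₛ-cong λ F → 𝟙-∧-* (isChamber D) _ (g F)) (∑ₛ-*ˡ {m} (𝟙 (isChamber D)) _)) ⟩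
    ∑ₛ m (λ D → 𝟙 (isChamber D) * ∑ₛ m (λ F → 𝟙 (inInterval (R C D) D F) * g F)) ∎
    where open ≡-Reasoning

  β≡∑ₛ : ∀ k → β Δ R C k ≡ ∑ₛ m (λ D → 𝟙 (isChamber D ∧ does (∣ R C D ∣ ≟ k)))
  β≡∑ₛ k = trans (countSubsets≡∑ₛ (λ D → isChamber D ∧ ⌊ ∣ R C D ∣ ≟ k ⌋))
                 (∑ₛ-cong λ D → cong (λ b → 𝟙 (isChamber D ∧ b)) (isYes≗does (∣ R C D ∣ ≟ k)))

  f≡∑ₛ : ∀ j → f j ≡ ∑ₛ m (λ F → 𝟙 (isFace F) * 𝟙 (does (∣ F ∣ ≟ j)))
  f≡∑ₛ j = trans (countSubsets≡∑ₛ (λ F → isFace F ∧ ⌊ ∣ F ∣ ≟ j ⌋)) (∑ₛ-cong λ F →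
    trans (𝟙-∧ (isFace F) _) (cong (λ b → 𝟙 (isFace F) * 𝟙 b) (isYes≗does (∣ F ∣ ≟ j))))

  f≡sumUpTo-β : ∀ {n} → Pure Δ n → ∀ {j} → j ≤ n →
                f j ≡ sumUpTo j (λ k → β Δ R C k * ((n ∸ k) choose (n ∸ j)))
  f≡sumUpTo-β {n} pure {j} j≤n = begin
    f j
      ≡⟨ f≡∑ₛ j ⟩
    ∑ₛ m (λ F → 𝟙 (isFace F) * 𝟙 (does (∣ F ∣ ≟ j)))
      ≡⟨ ∑ₛ-faces≡∑ₛ-chambers _ ⟩
    ∑ₛ m (λ D → 𝟙 (isChamber D) * intervalRankCount (R C D) D j)
      ≡⟨ ∑ₛ-cong (λ D → 𝟙-*-cong (isChamber D) λ chD →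
           intervalRankCount≡sumUpTo (R1-sub C D chC chD) (pure D chD) j≤n) ⟩
    ∑ₛ m (λ D → 𝟙 (isChamber D) * sumUpTo j (λ k → 𝟙 (does (∣ R C D ∣ ≟ k)) * c k))
      ≡⟨ ∑ₛ-cong (λ D → trans (sumUpTo-*ˡ j (𝟙 (isChamber D)) _)
                              (sumUpTo-cong j λ k → sym (𝟙-∧-* (isChamber D) _ (c k)))) ⟩
    ∑ₛ m (λ D → sumUpTo j (λ k → 𝟙 (isChamber D ∧ does (∣ R C D ∣ ≟ k)) * c k))
      ≡⟨ ∑ₛ-sumUpTo-comm {m} j _ ⟩
    sumUpTo j (λ k → ∑ₛ m (λ D → 𝟙 (isChamber D ∧ does (∣ R C D ∣ ≟ k)) * c k))
      ≡⟨ sumUpTo-cong j (λ k → trans (∑ₛ-*ʳ {m} (c k) _) (cong (_* c k) (sym (β≡∑ₛ k)))) ⟩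
    sumUpTo j (λ k → β Δ R C k * c k) ∎
    where
    open ≡-Reasoning
    c : ℕ → ℕ
    c k = (n ∸ k) choose (n ∸ j)

  β-isHVector : ∀ {n} → Pure Δ n → IsHVector Δ n (λ k → + β Δ R C k)
  β-isHVector {n} pure j j≤n = begin
    + f j                                ≡⟨ cong +_ (f≡sumUpTo-β pure j≤n) ⟩
    + sumUpTo j (λ k → β Δ R C k * c k)  ≡⟨ +-sumUpTo j _ ⟩
    sumTo j (λ k → + (β Δ R C k * c k))
      ≡⟨ sumTo-cong j (λ k _ → trans (cong +_ (*-comm _ (c k))) (pos-* (c k) _)) ⟩
    sumTo j (λ k → + c k *ℤ + β Δ R C k) ∎
    where
    open ≡-Reasoning
    c : ℕ → ℕ
    c k = (n ∸ k) choose (n ∸ j)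

unitriangular-injective : (c : ℕ → ℕ → ℤ) → (∀ j → c j j ≡ 1ℤ) → ∀ {N} {a b : ℕ → ℤ} →
  (∀ j → j ≤ N → sumTo j (λ k → c j k *ℤ a k) ≡ sumTo j (λ k → c j k *ℤ b k)) →
  ∀ j → j ≤ N → a j ≡ b j
unitriangular-injective c diag {N} {a} {b} eq j j≤N = agree-upTo j j≤N j ≤-refl
  where
  open ≡-Reasoning

  unit : ∀ j x → c j j *ℤ x ≡ x
  unit j x = trans (cong (_*ℤ x) (diag j)) (*-identityˡ x)

  agree-upTo : ∀ j → j ≤ N → ∀ k → k ≤ j → a k ≡ b k
  agree-upTo zero j≤N .zero z≤n = begin
    a 0           ≡⟨ unit 0 (a 0) ⟨
    c 0 0 *ℤ a 0  ≡⟨ eq 0 j≤N ⟩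
    c 0 0 *ℤ b 0  ≡⟨ unit 0 (b 0) ⟩
    b 0           ∎
  agree-upTo (suc j) j≤N k k≤1+j with m≤n⇒m<n∨m≡n k≤1+j
  ... | inj₁ (s≤s k≤j) = agree-upTo j (<⇒≤ j≤N) k k≤j
  ... | inj₂ refl = begin
    a (suc j)                       ≡⟨ unit (suc j) (a (suc j)) ⟨
    c (suc j) (suc j) *ℤ a (suc j)  ≡⟨ ∙-cancelˡ (sumTo j (λ k → c (suc j) k *ℤ b k)) _ _ last-terms ⟩
    c (suc j) (suc j) *ℤ b (suc j)  ≡⟨ unit (suc j) (b (suc j)) ⟩
    b (suc j)                       ∎
    where
    lower-terms : sumTo j (λ k → c (suc j) k *ℤ b k) ≡ sumTo j (λ k → c (suc j) k *ℤ a k)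
    lower-terms = sumTo-cong j λ k k≤j → cong (c (suc j) k *ℤ_) (sym (agree-upTo j (<⇒≤ j≤N) k k≤j))

    last-terms : sumTo j (λ k → c (suc j) k *ℤ b k) +ℤ c (suc j) (suc j) *ℤ a (suc j) ≡
                 sumTo j (λ k → c (suc j) k *ℤ b k) +ℤ c (suc j) (suc j) *ℤ b (suc j)
    last-terms = trans (cong (_+ℤ _) lower-terms) (eq (suc j) j≤N)

IsHVector-unique : ∀ {m n} (Δ : SimplicialComplex m) {h h′ : ℕ → ℤ} →
  IsHVector Δ n h → IsHVector Δ n h′ → ∀ j → j ≤ n → h j ≡ h′ j
IsHVector-unique {n = n} Δ hv hv′ = unitriangular-injective
  (λ j k → + ((n ∸ k) choose (n ∸ j)))
  (λ j → cong +_ (nCn≡1 (n ∸ j)))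
  (λ j j≤n → trans (sym (hv j j≤n)) (hv′ j j≤n))

proposition7p6 : (m n : ℕ) (Δ : SimplicialComplex m) → Pure Δ n →
    (R : Subset m → Subset m → Subset m) → IsRestriction Δ R →
    (C : Subset m) → SimplicialComplex.IsChamber Δ C →
    (h : ℕ → ℤ) → IsHVector Δ n h →
    ∀ j → j ≤ n → + (β Δ R C j) ≡ h j
proposition7p6 m n Δ pure R isR C chC h hv = IsHVector-unique Δ (β-isHVector Δ isR chC pure) hv
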